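{- Let $k\ge2$ and let $P$ be a $k$-polygon. Then $P$ has no triangle hitting set of size $k-1$, and $P$ has exactly two triangle hitting sets of size $k$: the set of its horizontal non-zero-length segments and the set of its vertical non-zero-length segments.
   Context: For $k\ge2$, a $k$-polygon is the intersection graph (vertices identified with segments) of $4k$ axis-parallel segments in the plane whose set is partitioned as $H\cup V\cup C$ where: $H$ is a set of $k$ pairwise disjoint horizontal segments of non-zero length; $V$ is a set of $k$ pairwise disjoint vertical segments of non-zero length; every segment of $H$ intersects exactly two segments of $V$ and vice versa; $C$ consists of zero-length segments (points) located at each intersection point of a segment of $H$ with a segment of $V$; and the intersection graph is connected. A triangle hitting set is a vertex set intersecting every triangle. -}

module Defs where

open import Level using (Level; _⊔_)
open import Data.Nat using (ℕ; _+_)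
open import Data.Fin using (Fin)
open import Data.Product using (Σ; ∃; _×_; _,_)
open import Data.Sum using (_⊎_)
open import Data.List using (List)
open import Data.List.Membership.Propositional using (_∈_)
open import Relation.Nullary using (¬_)
open import Relation.Binary.PropositionalEquality using (_≡_; _≢_)
open import Relation.Binary.Bundles using (TotalOrder)
open import Relation.Binary.Construct.Closure.ReflexiveTransitive using (Star)

-- Vertices of a k-polygon: k horizontal segments, k vertical segments,
-- and 2k = k + k zero-length segments (points).
data Vtx (k : ℕ) : Set where
  hor  : Fin k → Vtx k
  ver  : Fin k → Vtx k
  pt   : Fin (k + k) → Vtx k

-- Geometry over an arbitrary total order of coordinates (this includes the
-- real line).  A segment is an axis-parallel box [x₁,x₂] × [y₁,y₂].
module Geometry {c ℓ₁ ℓ₂ : Level} (O : TotalOrder c ℓ₁ ℓ₂) where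
  open TotalOrder O renaming (Carrier to R)

  record Segment : Set c where
    constructor seg
    field
      x₁ x₂ y₁ y₂ : R
  open Segment public

  _<_ : R → R → Set (ℓ₁ ⊔ ℓ₂)
  a < b = (a ≤ b) × ¬ (a ≈ b)

  IsHorizontal : Segment → Set (ℓ₁ ⊔ ℓ₂)
  IsHorizontal s = (y₁ s ≈ y₂ s) × (x₁ s < x₂ s)

  IsVertical : Segment → Set (ℓ₁ ⊔ ℓ₂)
  IsVertical s = (x₁ s ≈ x₂ s) × (y₁ s < y₂ s)

  IsPoint : Segment → Set ℓ₁
  IsPoint s = (x₁ s ≈ x₂ s) × (y₁ s ≈ y₂ s)

  Intersect : Segment → Segment → Set ℓ₂
  Intersect s t = (x₁ s ≤ x₂ t) × (x₁ t ≤ x₂ s) × (y₁ s ≤ y₂ t) × (y₁ t ≤ y₂ s)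

  Disjoint : Segment → Segment → Set ℓ₂
  Disjoint s t = ¬ Intersect s t

  LocatedAt : Segment → Segment → Segment → Set ℓ₁
  LocatedAt p h v = (x₁ p ≈ x₁ v) × (y₁ p ≈ y₁ h)

  SamePoint : Segment → Segment → Set ℓ₁
  SamePoint p q = (x₁ p ≈ x₁ q) × (y₁ p ≈ y₁ q)

  IntersectsExactlyTwo : {k : ℕ} → Segment → (Fin k → Segment) → Set ℓ₂
  IntersectsExactlyTwo s g =
    ∃ λ j₁ → ∃ λ j₂ → j₁ ≢ j₂ × Intersect s (g j₁) × Intersect s (g j₂)
      × (∀ j → Intersect s (g j) → (j ≡ j₁) ⊎ (j ≡ j₂))

  segOf′ : {k : ℕ} → (Fin k → Segment) → (Fin k → Segment) → (Fin (k + k) → Segment)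
         → Vtx k → Segment
  segOf′ H V C (hor i) = H i
  segOf′ H V C (ver j) = V j
  segOf′ H V C (pt m)  = C m

  Adj′ : {k : ℕ} → (Fin k → Segment) → (Fin k → Segment) → (Fin (k + k) → Segment)
       → Vtx k → Vtx k → Set ℓ₂
  Adj′ H V C u w = (u ≢ w) × Intersect (segOf′ H V C u) (segOf′ H V C w)

  record Polygon (k : ℕ) : Set (c ⊔ ℓ₁ ⊔ ℓ₂) where
    field
      H : Fin k → Segment
      V : Fin k → Segment
      C : Fin (k + k) → Segment
      H-horizontal : ∀ i → IsHorizontal (H i)
      V-vertical   : ∀ j → IsVertical (V j)
      C-point      : ∀ m → IsPoint (C m)
      H-disjoint   : ∀ i i′ → i ≢ i′ → Disjoint (H i) (H i′)
      V-disjoint   : ∀ j j′ → j ≢ j′ → Disjoint (V j) (V j′)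
      H-two        : ∀ i → IntersectsExactlyTwo (H i) V
      V-two        : ∀ j → IntersectsExactlyTwo (V j) H
      C-located    : ∀ m → ∃ λ i → ∃ λ j → Intersect (H i) (V j) × LocatedAt (C m) (H i) (V j)
      C-covers     : ∀ i j → Intersect (H i) (V j) → ∃ λ m → LocatedAt (C m) (H i) (V j)
      C-distinct   : ∀ m m′ → m ≢ m′ → ¬ SamePoint (C m) (C m′)
      connected    : ∀ u w → Star (Adj′ H V C) u w

    Adj : Vtx k → Vtx k → Set ℓ₂
    Adj = Adj′ H V C

  module _ {k : ℕ} (P : Polygon k) where
    open Polygon P

    IsTriangleHittingSet : List (Vtx k) → Set ℓ₂
    IsTriangleHittingSet S =
      ∀ a b d → Adj a b → Adj b d → Adj a d → (a ∈ S) ⊎ (b ∈ S) ⊎ (d ∈ S)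

IsHor : {k : ℕ} → Vtx k → Set
IsHor u = ∃ λ i → u ≡ hor i

IsVer : {k : ℕ} → Vtx k → Set
IsVer u = ∃ λ j → u ≡ ver j

{-# OPTIONS --safe #-}
-- Each point of C spans a triangle with the two segments crossing there, giving 2k triangles
-- that a hitting set S must meet.  A segment of H or V lies in at most two of them and a point
-- in one, so double counting gives k ≤ |S|.  If |S| = k the count is tight: S contains no point
-- and no triangle twice, so at every crossing exactly one of the two segments is in S, and
-- connectedness forces this to be the same side everywhere.  Conversely all of H (or all of V)
-- hits every triangle, because segments of the same family are pairwise disjoint.
module Submission where

open import Defs
open import Level using (Level)
open import Data.Nat using (ℕ; _≤_; _∸_)
open import Data.Product using (_×_)
open import Data.Sum using (_⊎_)
open import Data.List using (List; length)
open import Data.List.Relation.Unary.Unique.Propositional using (Unique)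
open import Data.List.Membership.Propositional using (_∈_)
open import Function.Bundles using (_⇔_)
open import Relation.Nullary using (¬_)
open import Relation.Binary.PropositionalEquality using (_≡_)
open import Relation.Binary.Bundles using (TotalOrder)

open import Data.Empty using (⊥; ⊥-elim)
open import Data.Fin using (Fin; zero; suc; punchIn; punchOut)
open import Data.Fin.Properties using (_≟_; punchInᵢ≢i; punchIn-punchOut)
open import Data.List using (lookup)
open import Data.List.Relation.Unary.Any using (index)
open import Data.List.Relation.Unary.Any.Properties using (lookup-index)
open import Data.Nat using (zero; suc; _+_; _*_; _<_; z≤n; s≤s)
open import Data.Nat.Properties
  using (+-0-commutativeMonoid; +-mono-≤; +-mono-<-≤; +-monoʳ-≤; m≤m+n; *-zeroʳ; *-cancelʳ-≤;
         ≤-trans; ≤-reflexive; ≤-<-trans; <-≤-trans; <-irrefl; 1+n≰n; module ≤-Reasoning)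
open import Data.Nat.Tactic.RingSolver using (solve-∀)
open import Algebra.Properties.CommutativeMonoid.Sum +-0-commutativeMonoid
  using (sum; sum-syntax; sum-remove; ∑-distrib-+; ∑-comm; sum-cong-≗)
open import Data.Product using (_,_; proj₁; proj₂)
open import Data.Sum using (inj₁; inj₂; [_,_]; map; map₂)
open import Function using (_∘_; id; const)
open import Function.Bundles using (mk⇔; Equivalence)
open import Function.Construct.Composition using (_⇔-∘_)
open import Function.Construct.Identity using (⇔-id)
open import Function.Construct.Symmetry using (⇔-sym)
open import Relation.Nullary using (Dec; yes; no; contradiction)
open import Relation.Nullary.Decidable using (decidable-stable)
open import Relation.Binary.Construct.Closure.ReflexiveTransitive using (fold)
open import Relation.Binary.PropositionalEquality
  using (_≢_; refl; sym; trans; cong; cong₂; subst; subst₂; module ≡-Reasoning)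

[n+n]*1≡n*2 : ∀ n → (n + n) * 1 ≡ n * 2
[n+n]*1≡n*2 = solve-∀

χ : ∀ {a} {A : Set a} → Dec A → ℕ
χ (yes _) = 1
χ (no _)  = 0

χ-yes : ∀ {a} {A : Set a} (d : Dec A) → A → χ d ≡ 1
χ-yes (yes _) _ = refl
χ-yes (no ¬a) a = ⊥-elim (¬a a)

χ-no : ∀ {a} {A : Set a} (d : Dec A) → ¬ A → χ d ≡ 0
χ-no (yes a) ¬a = ⊥-elim (¬a a)
χ-no (no _)  _  = refl

χ-≤-⊎ : ∀ {a b c} {A : Set a} {B : Set b} {C : Set c} (dA : Dec A) (dB : Dec B) (dC : Dec C) →
        (A → B ⊎ C) → χ dA ≤ χ dB + χ dC
χ-≤-⊎ (no _)  _       _       _ = z≤n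
χ-≤-⊎ (yes _) (yes _) _       _ = s≤s z≤n
χ-≤-⊎ (yes a) (no ¬b) dC      f with f a
... | inj₁ b = ⊥-elim (¬b b)
... | inj₂ c = ≤-reflexive (sym (χ-yes dC c))

∑-mono-≤ : ∀ {n} {f g : Fin n → ℕ} → (∀ i → f i ≤ g i) → sum f ≤ sum g
∑-mono-≤ {zero}  f≤g = z≤n
∑-mono-≤ {suc n} f≤g = +-mono-≤ (f≤g zero) (∑-mono-≤ (λ i → f≤g (suc i)))

∑-mono-< : ∀ {n} {f g : Fin n → ℕ} (a : Fin n) → (∀ i → f i ≤ g i) → f a < g a → sum f < sum g
∑-mono-< {suc n} {f} {g} a f≤g fa<ga = begin-strict
  sum f                          ≡⟨ sum-remove f ⟩
  f a + sum (f ∘ punchIn a)      <⟨ +-mono-<-≤ fa<ga (∑-mono-≤ (f≤g ∘ punchIn a)) ⟩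
  g a + sum (g ∘ punchIn a)      ≡⟨ sum-remove g ⟨
  sum g                          ∎
  where open ≤-Reasoning

∑-const : ∀ n c → ∑[ i < n ] c ≡ n * c
∑-const zero    c = refl
∑-const (suc n) c = cong (c +_) (∑-const n c)

term≤∑ : ∀ {n} (f : Fin n → ℕ) (a : Fin n) → f a ≤ sum f
term≤∑ {suc n} f a = ≤-trans (m≤m+n (f a) _) (≤-reflexive (sym (sum-remove f)))

pair≤∑ : ∀ {n} (f : Fin n → ℕ) {a b : Fin n} → a ≢ b → f a + f b ≤ sum f
pair≤∑ {suc n} f {a} {b} a≢b = begin
  f a + f b                           ≡⟨ cong (λ x → f a + f x) (punchIn-punchOut a≢b) ⟨
  f a + f (punchIn a (punchOut a≢b))  ≤⟨ +-monoʳ-≤ (f a) (term≤∑ (f ∘ punchIn a) (punchOut a≢b)) ⟩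
  f a + sum (f ∘ punchIn a)           ≡⟨ sum-remove f ⟨
  sum f                               ∎
  where open ≤-Reasoning

∑-δ : ∀ {n} (a : Fin n) → ∑[ i < n ] χ (i ≟ a) ≡ 1
∑-δ {suc n} a = begin
  ∑[ i < suc n ] χ (i ≟ a)                    ≡⟨ sum-remove (λ i → χ (i ≟ a)) ⟩
  χ (a ≟ a) + ∑[ i < n ] χ (punchIn a i ≟ a)  ≡⟨ cong₂ _+_ (χ-yes (a ≟ a) refl) (sum-cong-≗ off-a) ⟩
  1 + ∑[ i < n ] 0                            ≡⟨ cong suc (∑-const n 0) ⟩
  1 + n * 0                                   ≡⟨ cong suc (*-zeroʳ n) ⟩
  1                                           ∎
  where
  open ≡-Reasoning
  off-a : ∀ i → χ (punchIn a i ≟ a) ≡ 0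
  off-a i = χ-no (punchIn a i ≟ a) (punchInᵢ≢i a i)

count≤2 : ∀ {n p} {P : Fin n → Set p} (P? : ∀ i → Dec (P i)) (a b : Fin n) →
          (∀ i → P i → i ≡ a ⊎ i ≡ b) → ∑[ i < n ] χ (P? i) ≤ 2
count≤2 {n} P? a b P⊆ab = begin
  ∑[ i < n ] χ (P? i)                          ≤⟨ ∑-mono-≤ (λ i → χ-≤-⊎ (P? i) (i ≟ a) (i ≟ b) (P⊆ab i)) ⟩
  ∑[ i < n ] (χ (i ≟ a) + χ (i ≟ b))           ≡⟨ ∑-distrib-+ (λ i → χ (i ≟ a)) (λ i → χ (i ≟ b)) ⟩
  ∑[ i < n ] χ (i ≟ a) + ∑[ i < n ] χ (i ≟ b)  ≡⟨ cong₂ _+_ (∑-δ a) (∑-δ b) ⟩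
  2                                             ∎
  where open ≤-Reasoning

∈⇒≤∑ : ∀ {a} {A : Set a} {S : List A} (g : A → ℕ) {x} → x ∈ S → g x ≤ ∑[ p < length S ] g (lookup S p)
∈⇒≤∑ {S = S} g x∈S =
  subst (λ y → g y ≤ _) (sym (lookup-index x∈S)) (term≤∑ (g ∘ lookup S) (index x∈S))

∈-pair⇒≤∑ : ∀ {a} {A : Set a} {S : List A} (g : A → ℕ) {x y} → x ∈ S → y ∈ S → x ≢ y →
            g x + g y ≤ ∑[ p < length S ] g (lookup S p)
∈-pair⇒≤∑ {S = S} g {x} {y} x∈S y∈S x≢y =
  subst₂ (λ u v → g u + g v ≤ _) (sym (lookup-index x∈S)) (sym (lookup-index y∈S))
    (pair≤∑ (g ∘ lookup S) (λ i≡j → x≢y (trans (lookup-index x∈S) (trans (cong (lookup S) i≡j) (sym (lookup-index y∈S))))))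

module _ {c ℓ₁ ℓ₂ : Level} (O : TotalOrder c ℓ₁ ℓ₂) where
  open TotalOrder O using (module Eq) renaming (trans to ≤-trans′; reflexive to ≤-reflexive′; antisym to ≤-antisym′)
  open Geometry O hiding (_<_)

  Intersect-sym : ∀ {s t} → Intersect s t → Intersect t s
  Intersect-sym (a , b , c , d) = b , a , d , c

  Intersect-via-point : ∀ {p s t} → IsPoint p → Intersect s p → Intersect t p → Intersect s t
  Intersect-via-point (px , py) (s₁ , s₂ , s₃ , s₄) (t₁ , t₂ , t₃ , t₄) =
    ≤-trans′ s₁ (≤-trans′ (≤-reflexive′ (Eq.sym px)) t₂) ,
    ≤-trans′ t₁ (≤-trans′ (≤-reflexive′ (Eq.sym px)) s₂) ,
    ≤-trans′ s₃ (≤-trans′ (≤-reflexive′ (Eq.sym py)) t₄) ,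
    ≤-trans′ t₃ (≤-trans′ (≤-reflexive′ (Eq.sym py)) s₄)

  Intersect-points⇒SamePoint : ∀ {p q} → IsPoint p → IsPoint q → Intersect p q → SamePoint p q
  Intersect-points⇒SamePoint (px , py) (qx , qy) (a₁ , a₂ , a₃ , a₄) =
    ≤-antisym′ (≤-trans′ a₁ (≤-reflexive′ (Eq.sym qx))) (≤-trans′ a₂ (≤-reflexive′ (Eq.sym px))) ,
    ≤-antisym′ (≤-trans′ a₃ (≤-reflexive′ (Eq.sym qy))) (≤-trans′ a₄ (≤-reflexive′ (Eq.sym py)))

  LocatedAt⇒Intersect : ∀ {h v p} → IsHorizontal h → IsVertical v → IsPoint p → Intersect h v →
                        LocatedAt p h v → Intersect h p × Intersect v p
  LocatedAt⇒Intersect (hy , _) (vx , _) (px , py) (i₁ , i₂ , i₃ , i₄) (lx , ly) =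
    (≤-trans′ i₁ (≤-reflexive′ (Eq.trans (Eq.sym vx) (Eq.trans (Eq.sym lx) px))) ,
     ≤-trans′ (≤-reflexive′ lx) i₂ ,
     ≤-reflexive′ (Eq.trans (Eq.sym ly) py) ,
     ≤-reflexive′ (Eq.trans ly hy)) ,
    (≤-reflexive′ (Eq.trans (Eq.sym lx) px) ,
     ≤-reflexive′ (Eq.trans lx vx) ,
     ≤-trans′ i₄ (≤-reflexive′ (Eq.trans (Eq.sym hy) (Eq.trans (Eq.sym ly) py))) ,
     ≤-trans′ (≤-reflexive′ ly) i₃)

  module _ {k : ℕ} (P : Polygon k) where
    open Polygon P

    H-intersect⇒≡ : ∀ {i i′} → Intersect (H i) (H i′) → i ≡ i′
    H-intersect⇒≡ {i} {i′} I = decidable-stable (i ≟ i′) (λ i≢i′ → H-disjoint i i′ i≢i′ I)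

    V-intersect⇒≡ : ∀ {j j′} → Intersect (V j) (V j′) → j ≡ j′
    V-intersect⇒≡ {j} {j′} I = decidable-stable (j ≟ j′) (λ j≢j′ → V-disjoint j j′ j≢j′ I)

    ¬Adj-hor-hor : ∀ {i i′} → ¬ Adj (hor i) (hor i′)
    ¬Adj-hor-hor (u≢w , I) = u≢w (cong hor (H-intersect⇒≡ I))

    ¬Adj-ver-ver : ∀ {j j′} → ¬ Adj (ver j) (ver j′)
    ¬Adj-ver-ver (u≢w , I) = u≢w (cong ver (V-intersect⇒≡ I))

    ¬Adj-pt-pt : ∀ {m m′} → ¬ Adj (pt m) (pt m′)
    ¬Adj-pt-pt {m} {m′} (u≢w , I) = u≢w (cong pt (decidable-stable (m ≟ m′) (λ m≢m′ →
      C-distinct m m′ m≢m′ (Intersect-points⇒SamePoint (C-point m) (C-point m′) I))))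

    on-crossing : ∀ {i j m} → Intersect (H i) (V j) → LocatedAt (C m) (H i) (V j) →
                  Intersect (H i) (C m) × Intersect (V j) (C m)
    on-crossing {i} {j} {m} = LocatedAt⇒Intersect (H-horizontal i) (V-vertical j) (C-point m)

    row col : Fin (k + k) → Fin k
    row m = proj₁ (C-located m)
    col m = proj₁ (proj₂ (C-located m))

    row-col-intersect : ∀ m → Intersect (H (row m)) (V (col m))
    row-col-intersect m = proj₁ (proj₂ (proj₂ (C-located m)))

    located : ∀ m → LocatedAt (C m) (H (row m)) (V (col m))
    located m = proj₂ (proj₂ (proj₂ (C-located m)))

    row-unique : ∀ {i m} → Intersect (H i) (C m) → i ≡ row m
    row-unique {m = m} I =
      H-intersect⇒≡ (Intersect-via-point (C-point m) I (proj₁ (on-crossing (row-col-intersect m) (located m))))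

    col-unique : ∀ {j m} → Intersect (V j) (C m) → j ≡ col m
    col-unique {m = m} I =
      V-intersect⇒≡ (Intersect-via-point (C-point m) I (proj₂ (on-crossing (row-col-intersect m) (located m))))

    point-unique : ∀ {m m′} → row m ≡ row m′ → col m ≡ col m′ → m ≡ m′
    point-unique {m} {m′} r c = decidable-stable (m ≟ m′) (λ m≢m′ → C-distinct m m′ m≢m′
      ( Eq.trans (proj₁ (located m)) (Eq.trans (Eq.reflexive (cong (x₁ ∘ V) c)) (Eq.sym (proj₁ (located m′))))
      , Eq.trans (proj₂ (located m)) (Eq.trans (Eq.reflexive (cong (y₁ ∘ H) r)) (Eq.sym (proj₂ (located m′))))))

    crossing : ∀ {i j} → Intersect (H i) (V j) → Fin (k + k)
    crossing {i} {j} I = proj₁ (C-covers i j I)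

    crossing-located : ∀ {i j} (I : Intersect (H i) (V j)) → LocatedAt (C (crossing I)) (H i) (V j)
    crossing-located {i} {j} I = proj₂ (C-covers i j I)

    row-crossing : ∀ {i j} (I : Intersect (H i) (V j)) → row (crossing I) ≡ i
    row-crossing I = sym (row-unique (proj₁ (on-crossing I (crossing-located I))))

    col-crossing : ∀ {i j} (I : Intersect (H i) (V j)) → col (crossing I) ≡ j
    col-crossing I = sym (col-unique (proj₂ (on-crossing I (crossing-located I))))

    crossing-unique : ∀ {i j m} → row m ≡ i → col m ≡ j → (I : Intersect (H i) (V j)) → m ≡ crossing I
    crossing-unique r c I = point-unique (trans r (sym (row-crossing I))) (trans c (sym (col-crossing I)))

    triangle : ∀ {i j m} → Intersect (H i) (V j) → LocatedAt (C m) (H i) (V j) →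
               Adj (hor i) (ver j) × Adj (ver j) (pt m) × Adj (hor i) (pt m)
    triangle I L = ((λ ()) , I) , ((λ ()) , proj₂ (on-crossing I L)) , ((λ ()) , proj₁ (on-crossing I L))

    -- The triangles to be hit are indexed by the points: point m spans hor (row m), ver (col m), pt m.
    contains : Vtx k → Fin (k + k) → ℕ
    contains (hor i) m = χ (row m ≟ i)
    contains (ver j) m = χ (col m ≟ j)
    contains (pt m′) m = χ (m ≟ m′)

    degree : Vtx k → ℕ
    degree u = ∑[ m < k + k ] contains u m

    degree≤2 : ∀ u → degree u ≤ 2
    degree≤2 (hor i) with H-two i
    ... | j₁ , j₂ , _ , I₁ , I₂ , only = count≤2 (λ m → row m ≟ i) (crossing I₁) (crossing I₂) on-H
      where
      on-H : ∀ m → row m ≡ i → m ≡ crossing I₁ ⊎ m ≡ crossing I₂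
      on-H m r with only (col m) (subst (λ x → Intersect (H x) (V (col m))) r (row-col-intersect m))
      ... | inj₁ c = inj₁ (crossing-unique r c I₁)
      ... | inj₂ c = inj₂ (crossing-unique r c I₂)
    degree≤2 (ver j) with V-two j
    ... | i₁ , i₂ , _ , I₁ , I₂ , only =
      count≤2 (λ m → col m ≟ j) (crossing (Intersect-sym I₁)) (crossing (Intersect-sym I₂)) on-V
      where
      on-V : ∀ m → col m ≡ j → m ≡ crossing (Intersect-sym I₁) ⊎ m ≡ crossing (Intersect-sym I₂)
      on-V m c with only (row m) (Intersect-sym (subst (λ x → Intersect (H (row m)) (V x)) c (row-col-intersect m)))
      ... | inj₁ r = inj₁ (crossing-unique r c (Intersect-sym I₁))
      ... | inj₂ r = inj₂ (crossing-unique r c (Intersect-sym I₂))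
    degree≤2 (pt m′) = ≤-trans (≤-reflexive (∑-δ m′)) (s≤s z≤n)

    module HittingSet (S : List (Vtx k)) (hitting : IsTriangleHittingSet P S) where

      hits : Fin (k + k) → ℕ
      hits m = ∑[ p < length S ] contains (lookup S p) m

      ∑degree : ℕ
      ∑degree = ∑[ p < length S ] degree (lookup S p)

      hit-triangle : ∀ {i j m} → Intersect (H i) (V j) → LocatedAt (C m) (H i) (V j) →
                     hor i ∈ S ⊎ ver j ∈ S ⊎ pt m ∈ S
      hit-triangle I L with triangle I L
      ... | ab , bd , ad = hitting _ _ _ ab bd ad

      member-hits : ∀ {u m} → u ∈ S → contains u m ≡ 1 → 1 ≤ hits m
      member-hits {u} {m} u∈S c≡1 = subst (_≤ hits m) c≡1 (∈⇒≤∑ (λ w → contains w m) u∈S)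

      1≤hits : ∀ m → 1 ≤ hits m
      1≤hits m with hit-triangle (row-col-intersect m) (located m)
      ... | inj₁ h∈S        = member-hits h∈S (χ-yes (row m ≟ row m) refl)
      ... | inj₂ (inj₁ v∈S) = member-hits v∈S (χ-yes (col m ≟ col m) refl)
      ... | inj₂ (inj₂ p∈S) = member-hits p∈S (χ-yes (m ≟ m) refl)

      ∑hits≡∑degree : ∑[ m < k + k ] hits m ≡ ∑degree
      ∑hits≡∑degree = ∑-comm (λ m p → contains (lookup S p) m)

      ∑1≡k*2 : ∑[ m < k + k ] 1 ≡ k * 2
      ∑1≡k*2 = trans (∑-const (k + k) 1) ([n+n]*1≡n*2 k)

      k*2≤∑degree : k * 2 ≤ ∑degree
      k*2≤∑degree = begin
        k * 2                  ≡⟨ ∑1≡k*2 ⟨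
        ∑[ m < k + k ] 1       ≤⟨ ∑-mono-≤ 1≤hits ⟩
        ∑[ m < k + k ] hits m  ≡⟨ ∑hits≡∑degree ⟩
        ∑degree                ∎
        where open ≤-Reasoning

      k*2<∑degree : ∀ m → 2 ≤ hits m → k * 2 < ∑degree
      k*2<∑degree m 2≤hits = begin-strict
        k * 2                  ≡⟨ ∑1≡k*2 ⟨
        ∑[ m < k + k ] 1       <⟨ ∑-mono-< m 1≤hits 2≤hits ⟩
        ∑[ m < k + k ] hits m  ≡⟨ ∑hits≡∑degree ⟩
        ∑degree                ∎
        where open ≤-Reasoning

      ∑degree≤length*2 : ∑degree ≤ length S * 2
      ∑degree≤length*2 = subst (∑degree ≤_) (∑-const (length S) 2) (∑-mono-≤ (degree≤2 ∘ lookup S))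

      ∑degree<length*2 : ∀ {m} → pt m ∈ S → ∑degree < length S * 2
      ∑degree<length*2 {m} pt∈S = subst (∑degree <_) (∑-const (length S) 2)
        (∑-mono-< (index pt∈S) (degree≤2 ∘ lookup S)
          (subst (λ u → degree u < 2) (lookup-index pt∈S) (s≤s (≤-reflexive (∑-δ m)))))

      k≤length : k ≤ length S
      k≤length = *-cancelʳ-≤ k (length S) 2 (≤-trans k*2≤∑degree ∑degree≤length*2)

      module Minimum (length≡k : length S ≡ k) where

        k*2≡length*2 : k * 2 ≡ length S * 2
        k*2≡length*2 = cong (_* 2) (sym length≡k)

        pt∉S : ∀ m → ¬ pt m ∈ S
        pt∉S m pt∈S = <-irrefl k*2≡length*2 (≤-<-trans k*2≤∑degree (∑degree<length*2 pt∈S))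

        ¬hor∈S×ver∈S : ∀ {i j} → Intersect (H i) (V j) → hor i ∈ S → ver j ∈ S → ⊥
        ¬hor∈S×ver∈S I h∈S v∈S =
          <-irrefl k*2≡length*2 (<-≤-trans (k*2<∑degree (crossing I) 2≤hits) ∑degree≤length*2)
          where
          2≤hits : 2 ≤ hits (crossing I)
          2≤hits = subst (_≤ hits (crossing I))
            (cong₂ _+_ (χ-yes (row (crossing I) ≟ _) (row-crossing I)) (χ-yes (col (crossing I) ≟ _) (col-crossing I)))
            (∈-pair⇒≤∑ (λ u → contains u (crossing I)) h∈S v∈S (λ ()))

        hor∈S⊎ver∈S : ∀ {i j} → Intersect (H i) (V j) → hor i ∈ S ⊎ ver j ∈ S
        hor∈S⊎ver∈S I = map₂ [ id , ⊥-elim ∘ pt∉S _ ] (hit-triangle I (crossing-located I))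

        -- Whether S takes the horizontal segment at the crossing of u; since every crossing has
        -- exactly one of its two segments in S, this is invariant along edges.
        HorSide : Vtx k → Set
        HorSide (hor i) = hor i ∈ S
        HorSide (ver j) = ¬ ver j ∈ S
        HorSide (pt m)  = hor (row m) ∈ S

        HorSide-hor-ver : ∀ {i j} → Intersect (H i) (V j) → HorSide (hor i) ⇔ HorSide (ver j)
        HorSide-hor-ver I = mk⇔ (¬hor∈S×ver∈S I) λ v∉S → [ id , (λ v∈S → contradiction v∈S v∉S) ] (hor∈S⊎ver∈S I)

        HorSide-hor-pt : ∀ {i m} → Intersect (H i) (C m) → HorSide (hor i) ⇔ HorSide (pt m)
        HorSide-hor-pt {i} I = subst (λ x → HorSide (hor i) ⇔ (hor x ∈ S)) (row-unique I) (⇔-id _)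

        HorSide-ver-pt : ∀ {j m} → Intersect (V j) (C m) → HorSide (ver j) ⇔ HorSide (pt m)
        HorSide-ver-pt {m = m} I = subst (λ x → HorSide (ver x) ⇔ HorSide (pt m)) (sym (col-unique I))
          (⇔-sym (HorSide-hor-ver (row-col-intersect m)))

        HorSide-Adj : ∀ {u w} → Adj u w → HorSide u ⇔ HorSide w
        HorSide-Adj {hor _} {hor _} a       = ⊥-elim (¬Adj-hor-hor a)
        HorSide-Adj {hor _} {ver _} (_ , I) = HorSide-hor-ver I
        HorSide-Adj {hor _} {pt _}  (_ , I) = HorSide-hor-pt I
        HorSide-Adj {ver _} {hor _} (_ , I) = ⇔-sym (HorSide-hor-ver (Intersect-sym I))
        HorSide-Adj {ver _} {ver _} a       = ⊥-elim (¬Adj-ver-ver a)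
        HorSide-Adj {ver _} {pt _}  (_ , I) = HorSide-ver-pt I
        HorSide-Adj {pt _}  {hor _} (_ , I) = ⇔-sym (HorSide-hor-pt (Intersect-sym I))
        HorSide-Adj {pt _}  {ver _} (_ , I) = ⇔-sym (HorSide-ver-pt (Intersect-sym I))
        HorSide-Adj {pt _}  {pt _}  a       = ⊥-elim (¬Adj-pt-pt a)

        HorSide-constant : ∀ u w → HorSide u ⇔ HorSide w
        HorSide-constant u w =
          fold (λ u w → HorSide u ⇔ HorSide w) (λ a eq → eq ⇔-∘ HorSide-Adj a) (⇔-id _) (connected u w)

        S≡horizontals : (∀ u → HorSide u) → ∀ u → (u ∈ S) ⇔ IsHor u
        S≡horizontals side (hor i) = mk⇔ (const (i , refl)) (const (side (hor i)))
        S≡horizontals side (ver j) = mk⇔ (⊥-elim ∘ side (ver j)) λ ()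
        S≡horizontals side (pt m)  = mk⇔ (⊥-elim ∘ pt∉S m) λ ()

        S≡verticals : (∀ u → ¬ HorSide u) → ∀ u → (u ∈ S) ⇔ IsVer u
        S≡verticals ¬side (hor i) = mk⇔ (⊥-elim ∘ ¬side (hor i)) λ ()
        S≡verticals ¬side (ver j) = mk⇔ (const (j , refl)) (const ver∈S)
          where
          ver∈S : ver j ∈ S
          ver∈S with V-two j
          ... | i , _ , _ , I , _ = [ ⊥-elim ∘ ¬side (hor i) , id ] (hor∈S⊎ver∈S (Intersect-sym I))
        S≡verticals ¬side (pt m)  = mk⇔ (⊥-elim ∘ pt∉S m) λ ()

        horizontals⊎verticals : Fin k → (∀ u → (u ∈ S) ⇔ IsHor u) ⊎ (∀ u → (u ∈ S) ⇔ IsVer u)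
        horizontals⊎verticals i with H-two i
        ... | j , _ , _ , I , _ = map
          (λ h∈S → S≡horizontals (λ u → Equivalence.to (HorSide-constant (hor i) u) h∈S))
          (λ v∈S → S≡verticals (λ u side → Equivalence.to (HorSide-constant u (ver j)) side v∈S))
          (hor∈S⊎ver∈S I)

    triangle-has-horizontal : ∀ {a b d} → Adj a b → Adj b d → Adj a d → IsHor a ⊎ IsHor b ⊎ IsHor d
    triangle-has-horizontal {hor i}                   _  _  _  = inj₁ (i , refl)
    triangle-has-horizontal {_}     {hor i}           _  _  _  = inj₂ (inj₁ (i , refl))
    triangle-has-horizontal {_}     {_}     {hor i}   _  _  _  = inj₂ (inj₂ (i , refl))
    triangle-has-horizontal {ver _} {ver _}           ab _  _  = ⊥-elim (¬Adj-ver-ver ab)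
    triangle-has-horizontal {ver _} {pt _}  {ver _}   _  _  ad = ⊥-elim (¬Adj-ver-ver ad)
    triangle-has-horizontal {ver _} {pt _}  {pt _}    _  bd _  = ⊥-elim (¬Adj-pt-pt bd)
    triangle-has-horizontal {pt _}  {ver _} {ver _}   _  bd _  = ⊥-elim (¬Adj-ver-ver bd)
    triangle-has-horizontal {pt _}  {ver _} {pt _}    _  _  ad = ⊥-elim (¬Adj-pt-pt ad)
    triangle-has-horizontal {pt _}  {pt _}            ab _  _  = ⊥-elim (¬Adj-pt-pt ab)

    triangle-has-vertical : ∀ {a b d} → Adj a b → Adj b d → Adj a d → IsVer a ⊎ IsVer b ⊎ IsVer d
    triangle-has-vertical {ver j}                   _  _  _  = inj₁ (j , refl)
    triangle-has-vertical {_}     {ver j}           _  _  _  = inj₂ (inj₁ (j , refl))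
    triangle-has-vertical {_}     {_}     {ver j}   _  _  _  = inj₂ (inj₂ (j , refl))
    triangle-has-vertical {hor _} {hor _}           ab _  _  = ⊥-elim (¬Adj-hor-hor ab)
    triangle-has-vertical {hor _} {pt _}  {hor _}   _  _  ad = ⊥-elim (¬Adj-hor-hor ad)
    triangle-has-vertical {hor _} {pt _}  {pt _}    _  bd _  = ⊥-elim (¬Adj-pt-pt bd)
    triangle-has-vertical {pt _}  {hor _} {hor _}   _  bd _  = ⊥-elim (¬Adj-hor-hor bd)
    triangle-has-vertical {pt _}  {hor _} {pt _}    _  _  ad = ⊥-elim (¬Adj-pt-pt ad)
    triangle-has-vertical {pt _}  {pt _}            ab _  _  = ⊥-elim (¬Adj-pt-pt ab)

    horizontals-hit : ∀ S → (∀ u → IsHor u → u ∈ S) → IsTriangleHittingSet P S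
    horizontals-hit S ⊇H a b d ab bd ad = map (⊇H a) (map (⊇H b) (⊇H d)) (triangle-has-horizontal ab bd ad)

    verticals-hit : ∀ S → (∀ u → IsVer u → u ∈ S) → IsTriangleHittingSet P S
    verticals-hit S ⊇V a b d ab bd ad = map (⊇V a) (map (⊇V b) (⊇V d)) (triangle-has-vertical ab bd ad)

lemma43 : ∀ {c ℓ₁ ℓ₂ : Level} (O : TotalOrder c ℓ₁ ℓ₂) (k : ℕ) → 2 ≤ k
    → (P : Geometry.Polygon O k)
    → (∀ (S : List (Vtx k)) → Unique S → length S ≡ k ∸ 1
         → ¬ Geometry.IsTriangleHittingSet O P S)
    × (∀ (S : List (Vtx k)) → Unique S → length S ≡ k
         → (Geometry.IsTriangleHittingSet O P S
            ⇔ ((∀ u → (u ∈ S) ⇔ IsHor u) ⊎ (∀ u → (u ∈ S) ⇔ IsVer u))))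
lemma43 O (suc n) _ P = too-small , of-size-k
  where
  too-small : ∀ S → Unique S → length S ≡ n → ¬ Geometry.IsTriangleHittingSet O P S
  too-small S _ length≡n hitting = 1+n≰n (subst (suc n ≤_) length≡n (HittingSet.k≤length O P S hitting))

  of-size-k : ∀ S → Unique S → length S ≡ suc n →
              Geometry.IsTriangleHittingSet O P S ⇔ ((∀ u → (u ∈ S) ⇔ IsHor u) ⊎ (∀ u → (u ∈ S) ⇔ IsVer u))
  of-size-k S _ length≡k = mk⇔
    (λ hitting → HittingSet.Minimum.horizontals⊎verticals O P S hitting length≡k zero)
    [ (λ S≡H → horizontals-hit O P S (Equivalence.from ∘ S≡H)) , (λ S≡V → verticals-hit O P S (Equivalence.from ∘ S≡V)) ]
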